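{- Let $n\ge3$ be fixed and let $p$ be a prime. Then $D_n(p^m)\to\left(1-\dfrac{1}{p^{n-1}}\right)^n$ as $m\to\infty$.
   Context: For positive integers $k$, $D_n(k)=a'_n(k)/a_n(k)$, where $a_n(k)=\sum_{d_1\cdots d_n=k}d_1^0d_2^1\cdots d_n^{n-1}$ and $a'_n(k)=\sum_{d_1\cdots d_n=k}\prod_{i=1}^n\sum_{g\mid d_i}\mu(g)(d_i/g)^{i-1}$ (sums over tuples of positive integers with product $k$, $\mu$ the Möbius function). Equivalently, $D_n(k)=\lim_{T\to\infty}N'_{n,k}(T)/N_{n,k}(T)$, where $N_{n,k}(T)$ counts integer $n\times n$ matrices of determinant $k$ with $\sqrt{\operatorname{tr}(A^TA)}\le T$ and $N'_{n,k}(T)$ counts those with all rows primitive. -}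

module Defs where

open import Data.Bool using (Bool; true; false; if_then_else_; _∧_)
open import Data.Nat as ℕ using (ℕ; zero; suc; _≤ᵇ_)
open import Data.Nat.Divisibility using (_∣?_)
open import Data.Nat.Primality using (prime?)
open import Data.Integer as ℤ using (ℤ; +_)
open import Data.Rational as ℚ using (ℚ; 0ℚ; 1ℚ)
open import Data.List using (List; []; _∷_; map; concatMap; upTo; length; filter; foldr)
open import Data.Bool.ListAction using (any)
open import Relation.Nullary using (does)
open import Relation.Nullary.Decidable using (_×-dec_)

sumℤ : List ℤ → ℤ
sumℤ = foldr ℤ._+_ (+ 0)

divides? : ℕ → ℕ → Bool
divides? m k = does (m ∣? k)

μ : ℕ → ℤ
μ g =
  if any (λ d → (2 ≤ᵇ d) ∧ divides? (d ℕ.* d) g) (upTo (suc g))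
  then + 0
  else (ℤ.- (+ 1)) ℤ.^ length (filter (λ q → prime? q ×-dec q ∣? g) (upTo (suc g)))

J : ℕ → ℕ → ℤ
J s d = sumℤ (map (λ j → if divides? (suc j) d
                          then μ (suc j) ℤ.* (+ ((d ℕ./ suc j) ℕ.^ s))
                          else + 0) (upTo d))

factorizations : ℕ → ℕ → List (List ℕ)
factorizations zero k = if k ℕ.≡ᵇ 1 then [] ∷ [] else []
factorizations (suc n) k =
  concatMap (λ j → if divides? (suc j) k
                   then map (suc j ∷_) (factorizations n (k ℕ./ suc j))
                   else []) (upTo k)

weight : (ℕ → ℕ → ℤ) → ℕ → List ℕ → ℤ
weight f i [] = + 1
weight f i (d ∷ ds) = f i d ℤ.* weight f (suc i) ds

-- a_n(k) = Σ_{d₁⋯dₙ=k} d₁^0 d₂^1 ⋯ dₙ^{n-1}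
a : ℕ → ℕ → ℤ
a n k = sumℤ (map (weight (λ e d → + (d ℕ.^ e)) 0) (factorizations n k))

-- a'_n(k) = Σ_{d₁⋯dₙ=k} ∏_i Σ_{g∣d_i} μ(g)(d_i/g)^{i-1}
a′ : ℕ → ℕ → ℤ
a′ n k = sumℤ (map (weight J 0) (factorizations n k)) 

-- division x / y in ℚ, with the (never used here) convention x / 0 = 0
_÷ℕ_ : ℤ → ℕ → ℚ
x ÷ℕ zero = 0ℚ
x ÷ℕ suc m = x ℚ./ suc m

-- D_n(k) = a'_n(k) / a_n(k)   (a_n(k) ≥ 1 for k ≥ 1)
D : ℕ → ℕ → ℚ
D n k = a′ n k ÷ℕ ℤ.∣ a n k ∣

_^ℚ_ : ℚ → ℕ → ℚ
q ^ℚ zero = 1ℚ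
q ^ℚ suc m = q ℚ.* (q ^ℚ m)

-- For k = pᵐ both a_n and a'_n become coefficient extractions.  Tuples with product pᵐ are
-- exponent tuples summing to m, so a_n(pᵐ) is the coefficient of tᵐ in ∏_{i<n} 1/(1 − pⁱ t);
-- the inner sum of a'_n at pᵉ is p^{ie} − p^{i(e−1)} (μ vanishes on p², p³, …), so a'_n(pᵐ) is the
-- coefficient of (1 − t)ⁿ ∏_{i<n} 1/(1 − pⁱ t), i.e. the n-th difference Δⁿ A of A(m) = a_n(pᵐ).
-- Moving the dominant factor Q = p^{n−1} outermost, A(m+1) = B(m+1) + Q A(m) with B = O(Rᵐ),
-- R = Q/p.  Then Qⁿ Δⁿ A − (Q − 1)ⁿ A = O(Rᵐ) while A(m) ≥ Qᵐ, so
-- D_n(pᵐ) − (1 − 1/Q)ⁿ = O(p⁻ᵐ).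

module Submission where

open import Defs
open import Data.Bool using (Bool; true; false; if_then_else_; _∧_)
open import Data.Bool.ListAction using (any)
open import Data.Bool.Properties using (T-≡; T-∧; ∨-zeroʳ)
open import Data.Empty using (⊥-elim)
open import Data.Integer as ℤ using (ℤ; +_)
import Data.Integer.Properties as ℤP
open import Data.Integer.Tactic.RingSolver using (solve-∀)
open import Data.List using (List; []; _∷_; _∷ʳ_; _++_; map; concatMap; upTo; filter; length)
open import Data.List.Membership.Propositional using (_∈_)
open import Data.List.Membership.Propositional.Properties using (∈-upTo⁻; ∈-upTo⁺)
import Data.List.Properties as List
open import Data.List.Relation.Unary.All as All using (All; []; _∷_)
import Data.List.Relation.Unary.Any as Any
open import Data.Nat as ℕ using (ℕ; zero; suc; _≤_; z≤n; s≤s; _^_; _∸_; _≤ᵇ_)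
import Data.Nat.Properties as ℕP
import Data.Nat.Tactic.RingSolver as ℕSolver
open import Data.Nat.Coprimality using (Coprime; coprime-divisor)
open import Data.Nat.Divisibility using (_∣_; _∣?_; divides; ∣-refl; ∣1⇒≡1; *-cancelʳ-∣; m*n∣⇒m∣; ∣⇒≤; m∣m*n)
open import Data.Nat.DivMod using (m*n/n≡m; n/1≡n)
open import Data.Nat.Primality using (Prime; prime?; prime⇒irreducible; prime⇒nonZero; prime⇒nonTrivial; ¬prime[1])
open import Data.Product using (∃-syntax; _×_; _,_)
open import Data.Sum using (inj₁; inj₂)
open import Function using (_∘_; Equivalence)
open import Relation.Binary.PropositionalEquality hiding (J)
open import Relation.Nullary using (Dec; yes; no; does; ¬_)
open import Relation.Binary using (tri<; tri≈; tri>)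
open import Relation.Nullary.Decidable using (_×-dec_; dec-true; dec-false)

^-monoʳ-∣ : ∀ p {e m} → e ≤ m → p ^ e ∣ p ^ m
^-monoʳ-∣ p {e} {m} e≤m = divides (p ^ (m ∸ e)) (begin
  p ^ m              ≡⟨ cong (p ^_) (sym (ℕP.m∸n+n≡m e≤m)) ⟩
  p ^ (m ∸ e ℕ.+ e)  ≡⟨ ℕP.^-distribˡ-+-* p (m ∸ e) e ⟩
  p ^ (m ∸ e) ℕ.* p ^ e ∎)
  where open ≡-Reasoning

^-injectiveʳ : ∀ {p} → 1 ℕ.< p → ∀ {e f} → p ^ e ≡ p ^ f → e ≡ f
^-injectiveʳ {p} 1<p {e} {f} eq with ℕP.<-cmp e f
... | tri< e<f _ _ = ⊥-elim (ℕP.<-irrefl eq (ℕP.^-monoʳ-< p 1<p e<f))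
... | tri≈ _ e≡f _ = e≡f
... | tri> _ _ e>f = ⊥-elim (ℕP.<-irrefl (sym eq) (ℕP.^-monoʳ-< p 1<p e>f))

^-distribʳ-* : ∀ a b m → (a ℕ.* b) ^ m ≡ a ^ m ℕ.* b ^ m
^-distribʳ-* a b zero    = refl
^-distribʳ-* a b (suc m) = trans (cong (a ℕ.* b ℕ.*_) (^-distribʳ-* a b m)) (interchange a b (a ^ m) (b ^ m))
  where
  interchange : ∀ a b x y → a ℕ.* b ℕ.* (x ℕ.* y) ≡ a ℕ.* x ℕ.* (b ℕ.* y)
  interchange = ℕSolver.solve-∀

+-^ : ∀ a e → + (a ^ e) ≡ (+ a) ℤ.^ e
+-^ a zero    = refl
+-^ a (suc e) = trans (ℤP.pos-* a (a ^ e)) (cong (+ a ℤ.*_) (+-^ a e))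

m<p^m : ∀ {p} → 2 ≤ p → ∀ m → m ℕ.< p ^ m
m<p^m {p} 2≤p zero    = s≤s z≤n
m<p^m {p} 2≤p (suc m) = begin-strict
  suc m              <⟨ s≤s (m<p^m 2≤p m) ⟩
  suc (p ^ m)        ≤⟨ ℕP.+-monoˡ-≤ (p ^ m) (ℕP.m^n>0 p {{ℕ.>-nonZero (ℕP.<-≤-trans (s≤s z≤n) 2≤p)}} m) ⟩
  p ^ m ℕ.+ p ^ m    ≡⟨ cong (p ^ m ℕ.+_) (ℕP.+-identityʳ (p ^ m)) ⟨
  2 ℕ.* p ^ m        ≤⟨ ℕP.*-monoˡ-≤ (p ^ m) 2≤p ⟩
  p ℕ.* p ^ m        ∎
  where open ℕP.≤-Reasoning

dominated-< : ∀ {e c r d P A} → e ≤ c ℕ.* r → c ℕ.* d ℕ.< P → P ℕ.* r ≤ A → 1 ≤ r → e ℕ.* d ℕ.< A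
dominated-< {e} {c} {r} {d} {P} {A} e≤cr cd<P Pr≤A 1≤r = begin-strict
  e ℕ.* d            ≤⟨ ℕP.*-monoˡ-≤ d e≤cr ⟩
  c ℕ.* r ℕ.* d      ≡⟨ reorder c r d ⟩
  c ℕ.* d ℕ.* r      <⟨ ℕP.*-monoˡ-< r {{ℕ.>-nonZero 1≤r}} cd<P ⟩
  P ℕ.* r            ≤⟨ Pr≤A ⟩
  A                  ∎
  where
  open ℕP.≤-Reasoning
  reorder : ∀ c r d → c ℕ.* r ℕ.* d ≡ c ℕ.* d ℕ.* r
  reorder = ℕSolver.solve-∀

∣^∣ : ∀ i k → ℤ.∣ i ℤ.^ k ∣ ≡ ℤ.∣ i ∣ ^ k
∣^∣ i zero    = refl
∣^∣ i (suc k) = trans (ℤP.abs-* i (i ℤ.^ k)) (cong (ℤ.∣ i ∣ ℕ.*_) (∣^∣ i k))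

if-does-yes : ∀ {P : Set} {A : Set} (P? : Dec P) {x y : A} → P → (if does P? then x else y) ≡ x
if-does-yes P? p rewrite dec-true P? p = refl

if-does-no : ∀ {P : Set} {A : Set} (P? : Dec P) {x y : A} → ¬ P → (if does P? then x else y) ≡ y
if-does-no P? ¬p rewrite dec-false P? ¬p = refl

any-accept : ∀ {A : Set} (P : A → Bool) {x xs} → x ∈ xs → P x ≡ true → any P xs ≡ true
any-accept P (Any.here refl) Px rewrite Px = refl
any-accept P {xs = y ∷ _} (Any.there x∈xs) Px rewrite any-accept P x∈xs Px = ∨-zeroʳ (P y)

any-reject : ∀ {A : Set} (P : A → Bool) {xs} → All (λ x → P x ≡ false) xs → any P xs ≡ false
any-reject P []         = refl
any-reject P (Px ∷ Pxs) rewrite Px = any-reject P Pxs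

module _ where
  open import Data.Integer using (_+_; _*_)

  sumℤ-++ : ∀ xs ys → sumℤ (xs ++ ys) ≡ sumℤ xs + sumℤ ys
  sumℤ-++ []       ys = sym (ℤP.+-identityˡ _)
  sumℤ-++ (x ∷ xs) ys = trans (cong (λ s → x + s) (sumℤ-++ xs ys)) (sym (ℤP.+-assoc x _ _))

  sumℤ-map-*ˡ : ∀ c (xs : List ℤ) → sumℤ (map (c *_) xs) ≡ c * sumℤ xs
  sumℤ-map-*ˡ c []       = sym (ℤP.*-zeroʳ c)
  sumℤ-map-*ˡ c (x ∷ xs) = trans (cong (λ s → c * x + s) (sumℤ-map-*ˡ c xs)) (sym (ℤP.*-distribˡ-+ c x _))

  sumTo : (ℕ → ℤ) → ℕ → ℤ
  sumTo h zero    = h 0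
  sumTo h (suc m) = sumTo h m + h (suc m)

  sumTo-cong : ∀ {g h : ℕ → ℤ} m → (∀ e → e ≤ m → g e ≡ h e) → sumTo g m ≡ sumTo h m
  sumTo-cong zero    g≡h = g≡h 0 z≤n
  sumTo-cong (suc m) g≡h =
    cong₂ _+_ (sumTo-cong m (λ e e≤m → g≡h e (ℕP.m≤n⇒m≤1+n e≤m))) (g≡h (suc m) ℕP.≤-refl)

  sumTo-distrib-+ : ∀ (g h : ℕ → ℤ) m → sumTo (λ e → g e + h e) m ≡ sumTo g m + sumTo h m
  sumTo-distrib-+ g h zero    = refl
  sumTo-distrib-+ g h (suc m) = trans (cong (_+ (g (suc m) + h (suc m))) (sumTo-distrib-+ g h m))
                                      (interchange (sumTo g m) (sumTo h m) (g (suc m)) (h (suc m)))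
    where
    interchange : ∀ a b c d → (a + b) + (c + d) ≡ (a + c) + (b + d)
    interchange = solve-∀

  sumTo-*ˡ : ∀ c (h : ℕ → ℤ) m → sumTo (λ e → c * h e) m ≡ c * sumTo h m
  sumTo-*ˡ c h zero    = refl
  sumTo-*ˡ c h (suc m) = trans (cong (_+ c * h (suc m)) (sumTo-*ˡ c h m)) (sym (ℤP.*-distribˡ-+ c _ _))

  sumTo-suc : ∀ (h : ℕ → ℤ) m → sumTo h (suc m) ≡ h 0 + sumTo (h ∘ suc) m
  sumTo-suc h zero    = refl
  sumTo-suc h (suc m) = trans (cong (_+ h (suc (suc m))) (sumTo-suc h m)) (ℤP.+-assoc (h 0) _ _)

  sumTo-zero : ∀ (h : ℕ → ℤ) m → (∀ e → e ≤ m → h e ≡ + 0) → sumTo h m ≡ + 0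
  sumTo-zero h zero    h≡0 = h≡0 0 z≤n
  sumTo-zero h (suc m) h≡0 =
    cong₂ _+_ (sumTo-zero h m (λ e e≤m → h≡0 e (ℕP.m≤n⇒m≤1+n e≤m))) (h≡0 (suc m) ℕP.≤-refl)

  sumTo-single : ∀ (h : ℕ → ℤ) m e₀ → e₀ ≤ m → (∀ e → e ≤ m → e ≢ e₀ → h e ≡ + 0) → sumTo h m ≡ h e₀
  sumTo-single h zero .zero z≤n _ = refl
  sumTo-single h (suc m) e₀ e₀≤ h≡0 with e₀ ℕ.≟ suc m
  ... | yes refl =
    trans (cong (_+ h (suc m)) (sumTo-zero h m (λ e e≤m → h≡0 e (ℕP.m≤n⇒m≤1+n e≤m) (ℕP.<⇒≢ (s≤s e≤m)))))
          (ℤP.+-identityˡ _)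
  ... | no e₀≢ =
    trans (cong₂ _+_ (sumTo-single h m e₀ (ℕP.≤-pred (ℕP.≤∧≢⇒< e₀≤ e₀≢)) (λ e e≤m → h≡0 e (ℕP.m≤n⇒m≤1+n e≤m)))
                     (h≡0 (suc m) ℕP.≤-refl (e₀≢ ∘ sym)))
          (ℤP.+-identityʳ _)

  sumTo-first-two : ∀ (h : ℕ → ℤ) m → (∀ e → h (suc (suc e)) ≡ + 0) → sumTo h (suc m) ≡ h 0 + h 1
  sumTo-first-two h zero    _   = refl
  sumTo-first-two h (suc m) h≡0 = trans (cong₂ _+_ (sumTo-first-two h m h≡0) (h≡0 m)) (ℤP.+-identityʳ _)

-- k / d with the junk value k / 0 = 0, so that it can be applied to a divisor variable.
quot : ℕ → ℕ → ℕ
quot k zero    = 0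
quot k (suc d) = k ℕ./ suc d

quot-*ˡ : ∀ a b .{{_ : ℕ.NonZero b}} → quot (a ℕ.* b) b ≡ a
quot-*ˡ a (suc b) = m*n/n≡m a (suc b)

-- Divisor sums in the shape Defs uses: J s d unfolds to divisorSumUpTo _ d d.
divisorSumUpTo : (ℕ → ℤ) → ℕ → ℕ → ℤ
divisorSumUpTo h k N = sumℤ (map (λ j → if divides? (suc j) k then h (suc j) else + 0) (upTo N))

divisorSumUpTo-suc : ∀ h k N → divisorSumUpTo h k (suc N) ≡
                     divisorSumUpTo h k N ℤ.+ (if divides? (suc N) k then h (suc N) else + 0)
divisorSumUpTo-suc h k N = begin
  sumℤ (map term (upTo (suc N)))            ≡⟨ cong (sumℤ ∘ map term) (sym (List.upTo-∷ʳ N)) ⟩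
  sumℤ (map term (upTo N ++ N ∷ []))        ≡⟨ cong sumℤ (List.map-++ term (upTo N) (N ∷ [])) ⟩
  sumℤ (map term (upTo N) ++ term N ∷ [])   ≡⟨ sumℤ-++ (map term (upTo N)) (term N ∷ []) ⟩
  sumℤ (map term (upTo N)) ℤ.+ (term N ℤ.+ + 0)
                                            ≡⟨ cong (λ s → sumℤ (map term (upTo N)) ℤ.+ s) (ℤP.+-identityʳ (term N)) ⟩
  sumℤ (map term (upTo N)) ℤ.+ term N       ∎
  where
  open ≡-Reasoning
  term : ℕ → ℤ
  term j = if divides? (suc j) k then h (suc j) else + 0

-- a n k and a′ n k unfold to factorizationSum f n 0 k with f e d = + dᵉ and f = J respectively.
factorizationSum : (ℕ → ℕ → ℤ) → ℕ → ℕ → ℕ → ℤ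
factorizationSum f n i k = sumℤ (map (weight f i) (factorizations n k))

sumℤ-weight-prepend : ∀ f i d (L : List (List ℕ)) →
  sumℤ (map (weight f i) (map (d ∷_) L)) ≡ f i d ℤ.* sumℤ (map (weight f (suc i)) L)
sumℤ-weight-prepend f i d L = begin
  sumℤ (map (weight f i) (map (d ∷_) L))                 ≡⟨ cong sumℤ (sym (List.map-∘ L)) ⟩
  sumℤ (map (λ ds → f i d ℤ.* weight f (suc i) ds) L)    ≡⟨ cong sumℤ (List.map-∘ L) ⟩
  sumℤ (map (f i d ℤ.*_) (map (weight f (suc i)) L))     ≡⟨ sumℤ-map-*ˡ (f i d) (map (weight f (suc i)) L) ⟩
  f i d ℤ.* sumℤ (map (weight f (suc i)) L)              ∎
  where open ≡-Reasoning

sumℤ-weight-concatMap : ∀ f i (c : ℕ → Bool) (G : ℕ → List (List ℕ)) (L : List ℕ) →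
  sumℤ (map (weight f i) (concatMap (λ j → if c j then map (suc j ∷_) (G j) else []) L))
  ≡ sumℤ (map (λ j → if c j then f i (suc j) ℤ.* sumℤ (map (weight f (suc i)) (G j)) else + 0) L)
sumℤ-weight-concatMap f i c G []      = refl
sumℤ-weight-concatMap f i c G (j ∷ L) with c j
... | true  = begin
  sumℤ (map (weight f i) (map (suc j ∷_) (G j) ++ rest))
    ≡⟨ cong sumℤ (List.map-++ (weight f i) (map (suc j ∷_) (G j)) rest) ⟩
  sumℤ (map (weight f i) (map (suc j ∷_) (G j)) ++ map (weight f i) rest)
    ≡⟨ sumℤ-++ (map (weight f i) (map (suc j ∷_) (G j))) (map (weight f i) rest) ⟩
  sumℤ (map (weight f i) (map (suc j ∷_) (G j))) ℤ.+ sumℤ (map (weight f i) rest)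
    ≡⟨ cong₂ ℤ._+_ (sumℤ-weight-prepend f i (suc j) (G j)) (sumℤ-weight-concatMap f i c G L) ⟩
  _ ∎
  where
  open ≡-Reasoning
  rest = concatMap (λ j → if c j then map (suc j ∷_) (G j) else []) L
... | false = trans (sumℤ-weight-concatMap f i c G L) (sym (ℤP.+-identityˡ _))

factorizationSum-suc : ∀ f n i k → factorizationSum f (suc n) i k
  ≡ divisorSumUpTo (λ d → f i d ℤ.* factorizationSum f n (suc i) (quot k d)) k k
factorizationSum-suc f n i k =
  sumℤ-weight-concatMap f i (λ j → divides? (suc j) k) (λ j → factorizations n (k ℕ./ suc j)) (upTo k)

μ-squareful : ∀ {g d} .{{_ : ℕ.NonZero g}} → 2 ≤ d → d ℕ.* d ∣ g → μ g ≡ + 0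
μ-squareful {g} {d} 2≤d dd∣g =
  cong (λ b → if b then + 0 else (ℤ.- + 1) ℤ.^ length (filter (λ q → prime? q ×-dec q ∣? g) (upTo (suc g))))
       (any-accept squareTest d∈ d-passes)
  where
  squareTest = λ x → (2 ≤ᵇ x) ∧ divides? (x ℕ.* x) g
  d∈ : d ∈ upTo (suc g)
  d∈ = ∈-upTo⁺ (s≤s (ℕP.≤-trans (ℕP.m≤m*n d d {{ℕ.>-nonZero (ℕP.<-≤-trans (s≤s z≤n) 2≤d)}}) (∣⇒≤ dd∣g)))
  d-passes : squareTest d ≡ true
  d-passes = Equivalence.to T-≡ (Equivalence.from T-∧
               (ℕP.≤⇒≤ᵇ 2≤d , Equivalence.from T-≡ (dec-true (d ℕ.* d ∣? g) dd∣g)))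

-- Generating functions

module _ where
  open import Data.Integer using (_+_; _*_; _-_; -_)

  -- The coefficients of Y(t) / (1 − x t).
  geoConv : ℤ → (ℕ → ℤ) → ℕ → ℤ
  geoConv x Y zero    = Y 0
  geoConv x Y (suc m) = Y (suc m) + x * geoConv x Y m

  -- The coefficients of (1 − t) Y(t); the first one is Y 0.
  Δ : (ℕ → ℤ) → ℕ → ℤ
  Δ Y zero    = Y 0
  Δ Y (suc m) = Y (suc m) - Y m

  Δ^ : ℕ → (ℕ → ℤ) → ℕ → ℤ
  Δ^ zero    Y = Y
  Δ^ (suc k) Y = Δ (Δ^ k Y)

  δ : ℕ → ℤ
  δ zero    = + 1
  δ (suc _) = + 0

  geoConv-cong : ∀ x {Y Z} → Y ≗ Z → geoConv x Y ≗ geoConv x Z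
  geoConv-cong x Y≗Z zero    = Y≗Z 0
  geoConv-cong x Y≗Z (suc m) = cong₂ (λ a b → a + x * b) (Y≗Z (suc m)) (geoConv-cong x Y≗Z m)

  Δ-cong : ∀ {Y Z} → Y ≗ Z → Δ Y ≗ Δ Z
  Δ-cong Y≗Z zero    = Y≗Z 0
  Δ-cong Y≗Z (suc m) = cong₂ _-_ (Y≗Z (suc m)) (Y≗Z m)

  Δ^-cong : ∀ k {Y Z} → Y ≗ Z → Δ^ k Y ≗ Δ^ k Z
  Δ^-cong zero    Y≗Z = Y≗Z
  Δ^-cong (suc k) Y≗Z = Δ-cong (Δ^-cong k Y≗Z)

  geoConv-sum : ∀ x Y m → sumTo (λ e → x ℤ.^ e * Y (m ∸ e)) m ≡ geoConv x Y m
  geoConv-sum x Y zero    = ℤP.*-identityˡ (Y 0)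
  geoConv-sum x Y (suc m) = begin
    sumTo (λ e → x ℤ.^ e * Y (suc m ∸ e)) (suc m)
      ≡⟨ sumTo-suc _ m ⟩
    + 1 * Y (suc m) + sumTo (λ e → x * x ℤ.^ e * Y (m ∸ e)) m
      ≡⟨ cong₂ _+_ (ℤP.*-identityˡ (Y (suc m))) (sumTo-cong m (λ e _ → ℤP.*-assoc x (x ℤ.^ e) (Y (m ∸ e)))) ⟩
    Y (suc m) + sumTo (λ e → x * (x ℤ.^ e * Y (m ∸ e))) m
      ≡⟨ cong (λ s → Y (suc m) + s) (trans (sumTo-*ˡ x _ m) (cong (x *_) (geoConv-sum x Y m))) ⟩
    Y (suc m) + x * geoConv x Y m
      ∎
    where open ≡-Reasoning

  Δ-geoConv-sum : ∀ x Y m → sumTo (λ e → Δ (x ℤ.^_) e * Y (m ∸ e)) m ≡ Δ (geoConv x Y) m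
  Δ-geoConv-sum x Y zero    = ℤP.*-identityˡ (Y 0)
  Δ-geoConv-sum x Y (suc m) = begin
    sumTo (λ e → Δ (x ℤ.^_) e * Y (suc m ∸ e)) (suc m)
      ≡⟨ sumTo-suc _ m ⟩
    + 1 * Y (suc m) + sumTo (λ e → (x * x ℤ.^ e - x ℤ.^ e) * Y (m ∸ e)) m
      ≡⟨ cong (λ s → + 1 * Y (suc m) + s) (sumTo-cong m (λ e _ → factor x (x ℤ.^ e) (Y (m ∸ e)))) ⟩
    + 1 * Y (suc m) + sumTo (λ e → (x - + 1) * (x ℤ.^ e * Y (m ∸ e))) m
      ≡⟨ cong (λ s → + 1 * Y (suc m) + s) (trans (sumTo-*ˡ (x - + 1) _ m) (cong ((x - + 1) *_) (geoConv-sum x Y m))) ⟩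
    + 1 * Y (suc m) + (x - + 1) * geoConv x Y m
      ≡⟨ regroup (Y (suc m)) x (geoConv x Y m) ⟩
    (Y (suc m) + x * geoConv x Y m) - geoConv x Y m
      ∎
    where
    open ≡-Reasoning
    factor : ∀ x xᵉ y → (x * xᵉ - xᵉ) * y ≡ (x - + 1) * (xᵉ * y)
    factor = solve-∀
    regroup : ∀ y x g → + 1 * y + (x - + 1) * g ≡ (y + x * g) - g
    regroup = solve-∀

  geoConv-Δ : ∀ x Y → geoConv x (Δ Y) ≗ Δ (geoConv x Y)
  geoConv-Δ x Y zero          = refl
  geoConv-Δ x Y (suc zero)    = regroup (Y 1) (Y 0) x
    where
    regroup : ∀ y₁ y₀ x → (y₁ - y₀) + x * y₀ ≡ (y₁ + x * y₀) - y₀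
    regroup = solve-∀
  geoConv-Δ x Y (suc (suc m)) =
    trans (cong (λ s → Δ Y (suc (suc m)) + x * s) (geoConv-Δ x Y (suc m)))
          (regroup (Y (suc (suc m))) (Y (suc m)) x (geoConv x Y m))
    where
    regroup : ∀ y₂ y₁ x g → (y₂ - y₁) + x * ((y₁ + x * g) - g) ≡ (y₂ + x * (y₁ + x * g)) - (y₁ + x * g)
    regroup = solve-∀

  geoConv-Δ^ : ∀ x k Y → geoConv x (Δ^ k Y) ≗ Δ^ k (geoConv x Y)
  geoConv-Δ^ x zero    Y m = refl
  geoConv-Δ^ x (suc k) Y m = trans (geoConv-Δ x (Δ^ k Y) m) (Δ-cong (geoConv-Δ^ x k Y) m)

  -- (x − y) / ((1 − x t)(1 − y t)) = x / (1 − x t) − y / (1 − y t)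
  geoConv-partialFractions : ∀ x y Z m →
    (x - y) * geoConv x (geoConv y Z) m ≡ x * geoConv x Z m - y * geoConv y Z m
  geoConv-partialFractions x y Z zero    = distrib x y (Z 0)
    where
    distrib : ∀ x y z → (x - y) * z ≡ x * z - y * z
    distrib = solve-∀
  geoConv-partialFractions x y Z (suc m) = begin
    (x - y) * ((Z (suc m) + y * gy) + x * G)             ≡⟨ expand x y (Z (suc m)) gy G ⟩
    (x - y) * (Z (suc m) + y * gy) + x * ((x - y) * G)
      ≡⟨ cong (λ s → (x - y) * (Z (suc m) + y * gy) + x * s) (geoConv-partialFractions x y Z m) ⟩
    (x - y) * (Z (suc m) + y * gy) + x * (x * gx - y * gy) ≡⟨ collect x y (Z (suc m)) gx gy ⟩
    x * (Z (suc m) + x * gx) - y * (Z (suc m) + y * gy)   ∎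
    where
    open ≡-Reasoning
    G  = geoConv x (geoConv y Z) m
    gx = geoConv x Z m
    gy = geoConv y Z m
    expand : ∀ x y z gy G → (x - y) * ((z + y * gy) + x * G) ≡ (x - y) * (z + y * gy) + x * ((x - y) * G)
    expand = solve-∀
    collect : ∀ x y z gx gy → (x - y) * (z + y * gy) + x * (x * gx - y * gy) ≡ x * (z + x * gx) - y * (z + y * gy)
    collect = solve-∀

  geoConv-comm : ∀ x y Z → geoConv x (geoConv y Z) ≗ geoConv y (geoConv x Z)
  geoConv-comm x y Z zero    = refl
  geoConv-comm x y Z (suc m) = begin
    (Z (suc m) + y * gy) + x * G
      ≡⟨ rearrange x y (Z (suc m)) gx gy G ⟩
    (Z (suc m) + x * gx + y * G) + ((x - y) * G - (x * gx - y * gy))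
      ≡⟨ cong (λ s → (Z (suc m) + x * gx + y * G) + (s - (x * gx - y * gy))) (geoConv-partialFractions x y Z m) ⟩
    (Z (suc m) + x * gx + y * G) + ((x * gx - y * gy) - (x * gx - y * gy))
      ≡⟨ cancel (Z (suc m) + x * gx + y * G) (x * gx - y * gy) ⟩
    Z (suc m) + x * gx + y * G
      ≡⟨ cong (λ s → Z (suc m) + x * gx + y * s) (geoConv-comm x y Z m) ⟩
    Z (suc m) + x * gx + y * geoConv y (geoConv x Z) m
      ∎
    where
    open ≡-Reasoning
    G  = geoConv x (geoConv y Z) m
    gx = geoConv x Z m
    gy = geoConv y Z m
    rearrange : ∀ x y z gx gy G → (z + y * gy) + x * G ≡ (z + x * gx + y * G) + ((x - y) * G - (x * gx - y * gy))
    rearrange = solve-∀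
    cancel : ∀ w v → w + (v - v) ≡ w
    cancel = solve-∀

-- The coefficients of ∏_{x ∈ xs} 1 / (1 − x t).
geoProd : List ℕ → ℕ → ℤ
geoProd []       = δ
geoProd (x ∷ xs) = geoConv (+ x) (geoProd xs)

geoProd-∷ʳ : ∀ xs y → geoProd (xs ∷ʳ y) ≗ geoConv (+ y) (geoProd xs)
geoProd-∷ʳ []       y m = refl
geoProd-∷ʳ (x ∷ xs) y m =
  trans (geoConv-cong (+ x) (geoProd-∷ʳ xs y) m) (geoConv-comm (+ x) (+ y) (geoProd xs) m)

module _ where
  open import Data.Nat using (_+_; _*_)

  geoConvℕ : ℕ → (ℕ → ℕ) → ℕ → ℕ
  geoConvℕ x Y zero    = Y 0
  geoConvℕ x Y (suc m) = Y (suc m) + x * geoConvℕ x Y m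

  geoProdℕ : List ℕ → ℕ → ℕ
  geoProdℕ []       zero    = 1
  geoProdℕ []       (suc _) = 0
  geoProdℕ (x ∷ xs)         = geoConvℕ x (geoProdℕ xs)

  geoConv-+ : ∀ x (Y : ℕ → ℕ) m → geoConv (+ x) (+_ ∘ Y) m ≡ + geoConvℕ x Y m
  geoConv-+ x Y zero    = refl
  geoConv-+ x Y (suc m) = begin
    + Y (suc m) ℤ.+ + x ℤ.* geoConv (+ x) (+_ ∘ Y) m ≡⟨ cong (λ s → + Y (suc m) ℤ.+ + x ℤ.* s) (geoConv-+ x Y m) ⟩
    + Y (suc m) ℤ.+ + x ℤ.* + geoConvℕ x Y m         ≡⟨ cong (λ s → + Y (suc m) ℤ.+ s) (sym (ℤP.pos-* x _)) ⟩
    + Y (suc m) ℤ.+ + (x * geoConvℕ x Y m)           ≡⟨ sym (ℤP.pos-+ (Y (suc m)) _) ⟩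
    + geoConvℕ x Y (suc m)                           ∎
    where open ≡-Reasoning

  geoProd≡+geoProdℕ : ∀ xs m → geoProd xs m ≡ + geoProdℕ xs m
  geoProd≡+geoProdℕ []       zero    = refl
  geoProd≡+geoProdℕ []       (suc m) = refl
  geoProd≡+geoProdℕ (x ∷ xs) m       =
    trans (geoConv-cong (+ x) (geoProd≡+geoProdℕ xs) m) (geoConv-+ x (geoProdℕ xs) m)

  geoProdℕ-∷ʳ : ∀ xs y m → geoProdℕ (xs ∷ʳ y) m ≡ geoConvℕ y (geoProdℕ xs) m
  geoProdℕ-∷ʳ xs y m = ℤP.+-injective (begin
    + geoProdℕ (xs ∷ʳ y) m              ≡⟨ sym (geoProd≡+geoProdℕ (xs ∷ʳ y) m) ⟩
    geoProd (xs ∷ʳ y) m                 ≡⟨ geoProd-∷ʳ xs y m ⟩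
    geoConv (+ y) (geoProd xs) m        ≡⟨ geoConv-cong (+ y) (geoProd≡+geoProdℕ xs) m ⟩
    geoConv (+ y) (+_ ∘ geoProdℕ xs) m  ≡⟨ geoConv-+ y (geoProdℕ xs) m ⟩
    + geoConvℕ y (geoProdℕ xs) m        ∎)
    where open ≡-Reasoning

  geoProdℕ-zero : ∀ xs → geoProdℕ xs 0 ≡ 1
  geoProdℕ-zero []       = refl
  geoProdℕ-zero (x ∷ xs) = geoProdℕ-zero xs

  geoConvℕ-lower : ∀ x Y m → x ^ m * Y 0 ≤ geoConvℕ x Y m
  geoConvℕ-lower x Y zero    = ℕP.≤-reflexive (ℕP.*-identityˡ (Y 0))
  geoConvℕ-lower x Y (suc m) = begin
    x * x ^ m * Y 0       ≡⟨ ℕP.*-assoc x (x ^ m) (Y 0) ⟩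
    x * (x ^ m * Y 0)     ≤⟨ ℕP.*-monoʳ-≤ x (geoConvℕ-lower x Y m) ⟩
    x * geoConvℕ x Y m    ≤⟨ ℕP.m≤n+m (x * geoConvℕ x Y m) (Y (suc m)) ⟩
    geoConvℕ x Y (suc m)  ∎
    where open ℕP.≤-Reasoning

  geoConvℕ-upper : ∀ x y c (Y : ℕ → ℕ) → 2 * y ≤ x → (∀ j → Y j ≤ c * y ^ j) →
                   ∀ m → geoConvℕ x Y m ≤ 2 * c * x ^ m
  geoConvℕ-upper x y c Y 2y≤x Y≤ m = ℕP.≤-trans (ℕP.m≤m+n (geoConvℕ x Y m) (c * y ^ m)) (withSlack m)
    where
    open ℕP.≤-Reasoning
    withSlack : ∀ m → geoConvℕ x Y m + c * y ^ m ≤ 2 * c * x ^ m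
    withSlack zero = begin
      Y 0 + c * 1    ≤⟨ ℕP.+-monoˡ-≤ (c * 1) (Y≤ 0) ⟩
      c * 1 + c * 1  ≡⟨ double c ⟩
      2 * c * 1      ∎
      where
      double : ∀ c → c * 1 + c * 1 ≡ 2 * c * 1
      double = ℕSolver.solve-∀
    withSlack (suc m) = begin
      Y (suc m) + x * G + c * (y * y ^ m)
        ≤⟨ ℕP.+-monoˡ-≤ (c * (y * y ^ m)) (ℕP.+-monoˡ-≤ (x * G) (Y≤ (suc m))) ⟩
      c * (y * y ^ m) + x * G + c * (y * y ^ m) ≡⟨ collect c y (y ^ m) (x * G) ⟩
      x * G + c * y ^ m * (2 * y)               ≤⟨ ℕP.+-monoʳ-≤ (x * G) (ℕP.*-monoʳ-≤ (c * y ^ m) 2y≤x) ⟩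
      x * G + c * y ^ m * x                     ≡⟨ factor c x (y ^ m) G ⟩
      x * (G + c * y ^ m)                       ≤⟨ ℕP.*-monoʳ-≤ x (withSlack m) ⟩
      x * (2 * c * x ^ m)                       ≡⟨ reorder c x (x ^ m) ⟩
      2 * c * (x * x ^ m)                       ∎
      where
      G = geoConvℕ x Y m
      collect : ∀ c y yᵐ xG → c * (y * yᵐ) + xG + c * (y * yᵐ) ≡ xG + c * yᵐ * (2 * y)
      collect = ℕSolver.solve-∀
      factor : ∀ c x yᵐ G → x * G + c * yᵐ * x ≡ x * (G + c * yᵐ)
      factor = ℕSolver.solve-∀
      reorder : ∀ c x xᵐ → x * (2 * c * xᵐ) ≡ 2 * c * (x * xᵐ)
      reorder = ℕSolver.solve-∀

powersFrom : ℕ → ℕ → ℕ → List ℕ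
powersFrom p i zero    = []
powersFrom p i (suc n) = p ^ i ∷ powersFrom p (suc i) n

powersFrom-∷ʳ : ∀ p i n → powersFrom p i n ∷ʳ p ^ (i ℕ.+ n) ≡ powersFrom p i (suc n)
powersFrom-∷ʳ p i zero    = cong (λ e → p ^ e ∷ []) (ℕP.+-identityʳ i)
powersFrom-∷ʳ p i (suc n) = cong (p ^ i ∷_) (trans (cong (λ e → powersFrom p (suc i) n ∷ʳ p ^ e) (ℕP.+-suc i n))
                                                    (powersFrom-∷ʳ p (suc i) n))

geoProdℕ-powersFrom-upper : ∀ {p} → 2 ≤ p → ∀ j m → geoProdℕ (powersFrom p 0 (suc j)) m ≤ 2 ^ suc j ℕ.* (p ^ j) ^ m
geoProdℕ-powersFrom-upper {p} 2≤p zero    m = geoConvℕ-upper 1 0 1 (geoProdℕ []) z≤n δ≤ m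
  where
  δ≤ : ∀ j → geoProdℕ [] j ≤ 1 ℕ.* 0 ^ j
  δ≤ zero    = ℕP.≤-refl
  δ≤ (suc j) = z≤n
geoProdℕ-powersFrom-upper {p} 2≤p (suc j) m = begin
  geoProdℕ (powersFrom p 0 (suc (suc j))) m
    ≡⟨ cong (λ xs → geoProdℕ xs m) (sym (powersFrom-∷ʳ p 0 (suc j))) ⟩
  geoProdℕ (powersFrom p 0 (suc j) ∷ʳ p ^ suc j) m
    ≡⟨ geoProdℕ-∷ʳ (powersFrom p 0 (suc j)) (p ^ suc j) m ⟩
  geoConvℕ (p ^ suc j) (geoProdℕ (powersFrom p 0 (suc j))) m
    ≤⟨ geoConvℕ-upper (p ^ suc j) (p ^ j) (2 ^ suc j) _ (ℕP.*-monoˡ-≤ (p ^ j) 2≤p)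
                      (geoProdℕ-powersFrom-upper 2≤p j) m ⟩
  2 ^ suc (suc j) ℕ.* (p ^ suc j) ^ m
    ∎
  where open ℕP.≤-Reasoning

-- Differences of a geometric convolution

∣Δ∣-upper : ∀ (F : ℕ → ℤ) c R → (∀ m → ℤ.∣ F m ∣ ≤ c ℕ.* R ^ m) →
            ∀ m → R ℕ.* ℤ.∣ Δ F m ∣ ≤ (R ℕ.+ 1) ℕ.* c ℕ.* R ^ m
∣Δ∣-upper F c R F≤ zero    = begin
  R ℕ.* ℤ.∣ F 0 ∣        ≤⟨ ℕP.*-monoʳ-≤ R (F≤ 0) ⟩
  R ℕ.* (c ℕ.* 1)        ≤⟨ ℕP.*-monoˡ-≤ (c ℕ.* 1) (ℕP.m≤m+n R 1) ⟩
  (R ℕ.+ 1) ℕ.* (c ℕ.* 1) ≡⟨ ℕP.*-assoc (R ℕ.+ 1) c 1 ⟨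
  (R ℕ.+ 1) ℕ.* c ℕ.* 1  ∎
  where open ℕP.≤-Reasoning
∣Δ∣-upper F c R F≤ (suc m) = begin
  R ℕ.* ℤ.∣ F (suc m) ℤ.- F m ∣               ≤⟨ ℕP.*-monoʳ-≤ R (ℤP.∣i-j∣≤∣i∣+∣j∣ (F (suc m)) (F m)) ⟩
  R ℕ.* (ℤ.∣ F (suc m) ∣ ℕ.+ ℤ.∣ F m ∣)       ≤⟨ ℕP.*-monoʳ-≤ R (ℕP.+-mono-≤ (F≤ (suc m)) (F≤ m)) ⟩
  R ℕ.* (c ℕ.* (R ℕ.* R ^ m) ℕ.+ c ℕ.* R ^ m) ≡⟨ collect R c (R ^ m) ⟩
  (R ℕ.+ 1) ℕ.* c ℕ.* (R ℕ.* R ^ m)           ∎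
  where
  open ℕP.≤-Reasoning
  collect : ∀ R c Rᵐ → R ℕ.* (c ℕ.* (R ℕ.* Rᵐ) ℕ.+ c ℕ.* Rᵐ) ≡ (R ℕ.+ 1) ℕ.* c ℕ.* (R ℕ.* Rᵐ)
  collect = ℕSolver.solve-∀

module _ where
  open import Data.Integer using (_+_; _*_; _-_)

  -- Qᵏ times the deviation of Δᵏ A from (1 − 1/Q)ᵏ A, for A = geoConv Q B.
  Δ^-defect : ℕ → (ℕ → ℤ) → ℕ → ℕ → ℤ
  Δ^-defect Q B k m = (+ Q) ℤ.^ k * Δ^ k A m - (+ Q - + 1) ℤ.^ k * A m
    where A = geoConv (+ Q) B

  Δ^-defect-zero : ∀ Q B m → Δ^-defect Q B 0 m ≡ + 0
  Δ^-defect-zero Q B m = cancel (geoConv (+ Q) B m)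
    where
    cancel : ∀ a → + 1 * a - + 1 * a ≡ + 0
    cancel = solve-∀

  Δ^-defect-suc : ∀ Q B k m →
    Δ^-defect Q B (suc k) m ≡ + Q * Δ (Δ^-defect Q B k) m + (+ Q - + 1) ℤ.^ k * B m
  Δ^-defect-suc Q B k zero    =
    identity (+ Q) ((+ Q) ℤ.^ k) ((+ Q - + 1) ℤ.^ k) (Δ^ k (geoConv (+ Q) B) 0) (B 0)
    where
    identity : ∀ Q Qᵏ Cᵏ d a → Q * Qᵏ * d - (Q - + 1) * Cᵏ * a ≡ Q * (Qᵏ * d - Cᵏ * a) + Cᵏ * a
    identity = solve-∀
  Δ^-defect-suc Q B k (suc m) =
    identity (+ Q) ((+ Q) ℤ.^ k) ((+ Q - + 1) ℤ.^ k)
             (Δ^ k (geoConv (+ Q) B) (suc m)) (Δ^ k (geoConv (+ Q) B) m) (geoConv (+ Q) B m) (B (suc m))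
    where
    identity : ∀ Q Qᵏ Cᵏ d₁ d₀ a b →
      Q * Qᵏ * (d₁ - d₀) - (Q - + 1) * Cᵏ * (b + Q * a)
      ≡ Q * ((Qᵏ * d₁ - Cᵏ * (b + Q * a)) - (Qᵏ * d₀ - Cᵏ * a)) + Cᵏ * b
    identity = solve-∀

Δ^-defectBound : (s R K : ℕ) → ℕ → ℕ
Δ^-defectBound s R K zero    = 0
Δ^-defectBound s R K (suc k) = s ℕ.* ((R ℕ.+ 1) ℕ.* Δ^-defectBound s R K k) ℕ.+ (s ℕ.* R) ^ k ℕ.* K

module _ (B : ℕ → ℤ) (s R K : ℕ) (1≤sR : 1 ≤ s ℕ.* R) (B≤ : ∀ m → ℤ.∣ B m ∣ ≤ K ℕ.* R ^ m) where
  open import Data.Nat using (_+_; _*_)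

  ∣Δ^-defect∣-upper : ∀ k m → ℤ.∣ Δ^-defect (s * R) B k m ∣ ≤ Δ^-defectBound s R K k * R ^ m
  ∣Δ^-defect∣-upper zero    m rewrite Δ^-defect-zero (s * R) B m = z≤n
  ∣Δ^-defect∣-upper (suc k) m rewrite Δ^-defect-suc (s * R) B k m = begin
    ℤ.∣ + (s * R) ℤ.* Δ E m ℤ.+ C ℤ.* B m ∣
      ≤⟨ ℤP.∣i+j∣≤∣i∣+∣j∣ (+ (s * R) ℤ.* Δ E m) (C ℤ.* B m) ⟩
    ℤ.∣ + (s * R) ℤ.* Δ E m ∣ + ℤ.∣ C ℤ.* B m ∣
      ≡⟨ cong₂ _+_ (ℤP.abs-* (+ (s * R)) (Δ E m)) (ℤP.abs-* C (B m)) ⟩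
    s * R * ℤ.∣ Δ E m ∣ + ℤ.∣ C ∣ * ℤ.∣ B m ∣
      ≡⟨ cong (_+ ℤ.∣ C ∣ * ℤ.∣ B m ∣) (ℕP.*-assoc s R _) ⟩
    s * (R * ℤ.∣ Δ E m ∣) + ℤ.∣ C ∣ * ℤ.∣ B m ∣
      ≤⟨ ℕP.+-mono-≤ (ℕP.*-monoʳ-≤ s (∣Δ∣-upper E _ R (∣Δ^-defect∣-upper k) m)) (ℕP.*-mono-≤ ∣C∣≤ (B≤ m)) ⟩
    s * ((R + 1) * Δ^-defectBound s R K k * R ^ m) + (s * R) ^ k * (K * R ^ m)
      ≡⟨ collect s (R + 1) (Δ^-defectBound s R K k) ((s * R) ^ k) K (R ^ m) ⟩
    Δ^-defectBound s R K (suc k) * R ^ m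
      ∎
    where
    open ℕP.≤-Reasoning
    E = Δ^-defect (s * R) B k
    C = (+ (s * R) ℤ.- + 1) ℤ.^ k
    ∣C∣≤ : ℤ.∣ C ∣ ≤ (s * R) ^ k
    ∣C∣≤ = ℕP.≤-trans (ℕP.≤-reflexive (∣^∣ _ k)) (ℕP.^-monoˡ-≤ k (∣Q-1∣≤Q 1≤sR))
      where
      ∣Q-1∣≤Q : ∀ {Q} → 1 ≤ Q → ℤ.∣ + Q ℤ.- + 1 ∣ ≤ Q
      ∣Q-1∣≤Q {suc Q} _ = ℕP.n≤1+n Q
    collect : ∀ s r c Qᵏ K Rᵐ → s * (r * c * Rᵐ) + Qᵏ * (K * Rᵐ) ≡ (s * (r * c) + Qᵏ * K) * Rᵐ
    collect = ℕSolver.solve-∀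

open import Data.Rational as ℚ using (ℚ; 0ℚ; 1ℚ; mkℚ; toℚᵘ; _<_; _-_; ∣_∣; *<*)
import Data.Rational.Properties as ℚP
open import Data.Rational.Unnormalised as ℚᵘ using (ℚᵘ; mkℚᵘ; 1ℚᵘ; ↥_; ↧_; *<*) renaming (_≃_ to _≃ᵘ_)
import Data.Rational.Unnormalised.Properties as ℚᵘP

powᵘ : ℚᵘ → ℕ → ℚᵘ
powᵘ y zero    = 1ℚᵘ
powᵘ y (suc n) = y ℚᵘ.* powᵘ y n

powᵘ-cong : ∀ {x y} n → x ≃ᵘ y → powᵘ x n ≃ᵘ powᵘ y n
powᵘ-cong zero    x≃y = ℚᵘP.≃-refl
powᵘ-cong (suc n) x≃y = ℚᵘP.*-cong x≃y (powᵘ-cong n x≃y)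

↥-* : ∀ p q → ↥ (p ℚᵘ.* q) ≡ ↥ p ℤ.* ↥ q
↥-* (mkℚᵘ _ _) (mkℚᵘ _ _) = refl

↧-* : ∀ p q → ↧ (p ℚᵘ.* q) ≡ ↧ p ℤ.* ↧ q
↧-* (mkℚᵘ _ d) (mkℚᵘ _ e) = ℤP.pos-* (suc d) (suc e)

↥-powᵘ : ∀ y n → ↥ (powᵘ y n) ≡ (↥ y) ℤ.^ n
↥-powᵘ y zero    = refl
↥-powᵘ y (suc n) = trans (↥-* y (powᵘ y n)) (cong (↥ y ℤ.*_) (↥-powᵘ y n))

↧-powᵘ : ∀ y n → ↧ (powᵘ y n) ≡ (↧ y) ℤ.^ n
↧-powᵘ y zero    = refl
↧-powᵘ y (suc n) = trans (↧-* y (powᵘ y n)) (cong (↧ y ℤ.*_) (↧-powᵘ y n))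

toℚᵘ-^ℚ : ∀ x n → toℚᵘ (x ^ℚ n) ≃ᵘ powᵘ (toℚᵘ x) n
toℚᵘ-^ℚ x zero    = ℚᵘP.≃-refl
toℚᵘ-^ℚ x (suc n) = ℚᵘP.≃-trans (ℚP.toℚᵘ-homo-* x (x ^ℚ n)) (ℚᵘP.*-congˡ {toℚᵘ x} (toℚᵘ-^ℚ x n))

toℚᵘ-÷ℕ : ∀ x d .{{_ : ℕ.NonZero d}} → toℚᵘ (x ÷ℕ d) ≃ᵘ x ℚᵘ./ d
toℚᵘ-÷ℕ x (suc d) = ℚP.toℚᵘ-fromℚᵘ (mkℚᵘ x d)

∣÷ℕ-∣<-cross : ∀ x X .{{_ : ℕ.NonZero X}} (y : ℚ) (v : ℚᵘ) (ε : ℚ) → toℚᵘ y ≃ᵘ v →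
  + ℤ.∣ x ℤ.* ↧ v ℤ.- ↥ v ℤ.* + X ∣ ℤ.* ℚ.↧ ε ℤ.< ℚ.↥ ε ℤ.* (+ X ℤ.* ↧ v) →
  ∣ x ÷ℕ X - y ∣ < ε
∣÷ℕ-∣<-cross x (suc X) y v@(mkℚᵘ b B) ε@(mkℚ _ _ _) y≃v cross =
  ℚP.toℚᵘ-cancel-< (ℚᵘP.<-respˡ-≃ (ℚᵘP.≃-sym toℚᵘ≃) (*<* cross′))
  where
  toℚᵘ≃ : toℚᵘ ∣ x ÷ℕ suc X - y ∣ ≃ᵘ ℚᵘ.∣ mkℚᵘ x X ℚᵘ.- v ∣
  toℚᵘ≃ = ℚᵘP.≃-trans (ℚP.toℚᵘ-homo-∣-∣ (x ÷ℕ suc X - y)) (ℚᵘP.∣-∣-cong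
            (ℚᵘP.≃-trans (ℚP.toℚᵘ-homo-+ (x ÷ℕ suc X) (ℚ.- y))
                         (ℚᵘP.+-cong (toℚᵘ-÷ℕ x (suc X)) (ℚᵘP.≃-trans (ℚP.toℚᵘ-homo‿- y) (ℚᵘP.-‿cong y≃v)))))
  cross′ : + ℤ.∣ x ℤ.* + suc B ℤ.+ (ℤ.- b) ℤ.* + suc X ∣ ℤ.* ℚ.↧ ε ℤ.< ℚ.↥ ε ℤ.* + (suc X ℕ.* suc B)
  cross′ rewrite sym (ℤP.neg-distribˡ-* b (+ suc X)) | ℤP.pos-* (suc X) (suc B) = cross

↥-1-1/suc : ∀ q → ↥ (1ℚᵘ ℚᵘ.- (+ 1) ℚᵘ./ suc q) ≡ + suc q ℤ.- + 1
↥-1-1/suc q = identity (+ suc q)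
  where
  identity : ∀ a → + 1 ℤ.* a ℤ.+ (ℤ.- + 1) ℤ.* + 1 ≡ a ℤ.- + 1
  identity = solve-∀

↧-1-1/suc : ∀ q → ↧ (1ℚᵘ ℚᵘ.- (+ 1) ℚᵘ./ suc q) ≡ + suc q
↧-1-1/suc q = cong (λ n → + suc n) (ℕP.+-identityʳ q)

∣÷ℕ-[1-1/Q]^∣<-cross : ∀ x X .{{_ : ℕ.NonZero X}} Q .{{_ : ℕ.NonZero Q}} N ε →
  + ℤ.∣ (+ Q) ℤ.^ N ℤ.* x ℤ.- (+ Q ℤ.- + 1) ℤ.^ N ℤ.* + X ∣ ℤ.* ℚ.↧ ε ℤ.< ℚ.↥ ε ℤ.* (+ X ℤ.* (+ Q) ℤ.^ N) →
  ∣ x ÷ℕ X - (1ℚ - (+ 1) ÷ℕ Q) ^ℚ N ∣ < ε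
∣÷ℕ-[1-1/Q]^∣<-cross x X (suc q) N ε cross = ∣÷ℕ-∣<-cross x X _ (powᵘ w N) ε T≃ cross′
  where
  w = 1ℚᵘ ℚᵘ.- (+ 1) ℚᵘ./ suc q
  T≃ : toℚᵘ ((1ℚ - (+ 1) ÷ℕ suc q) ^ℚ N) ≃ᵘ powᵘ w N
  T≃ = ℚᵘP.≃-trans (toℚᵘ-^ℚ (1ℚ - 1/Q) N) (powᵘ-cong N (ℚᵘP.≃-trans (ℚP.toℚᵘ-homo-+ 1ℚ (ℚ.- 1/Q))
         (ℚᵘP.+-congʳ 1ℚᵘ (ℚᵘP.≃-trans (ℚP.toℚᵘ-homo‿- 1/Q) (ℚᵘP.-‿cong (toℚᵘ-÷ℕ (+ 1) (suc q)))))))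
    where 1/Q = (+ 1) ÷ℕ suc q
  CrossHolds : ℤ → ℤ → ℤ → Set
  CrossHolds xd u d = + ℤ.∣ xd ℤ.- u ℤ.* + X ∣ ℤ.* ℚ.↧ ε ℤ.< ℚ.↥ ε ℤ.* (+ X ℤ.* d)
  cross′ : CrossHolds (x ℤ.* ↧ powᵘ w N) (↥ powᵘ w N) (↧ powᵘ w N)
  cross′ = subst₂ (λ u d → CrossHolds (x ℤ.* d) u d)
                  (sym (trans (↥-powᵘ w N) (cong (ℤ._^ N) (↥-1-1/suc q))))
                  (sym (trans (↧-powᵘ w N) (cong (ℤ._^ N) (↧-1-1/suc q))))
                  (subst (λ xd → CrossHolds xd ((+ suc q ℤ.- + 1) ℤ.^ N) ((+ suc q) ℤ.^ N))
                         (ℤP.*-comm ((+ suc q) ℤ.^ N) x) cross)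

-- Prime powers

module PrimePower {p : ℕ} (p-prime : Prime p) where
  private
    instance
      p≢0 : ℕ.NonZero p
      p≢0 = prime⇒nonZero p-prime
    1<p : 1 ℕ.< p
    1<p = ℕ.nonTrivial⇒n>1 p {{prime⇒nonTrivial p-prime}}

  primeDivisors-prime : filter (λ q → prime? q ×-dec q ∣? p) (upTo (suc p)) ≡ p ∷ []
  primeDivisors-prime = begin
    filter P? (upTo (suc p))                  ≡⟨ cong (filter P?) (sym (List.upTo-∷ʳ p)) ⟩
    filter P? (upTo p ++ p ∷ [])              ≡⟨ List.filter-++ P? (upTo p) (p ∷ []) ⟩
    filter P? (upTo p) ++ filter P? (p ∷ [])  ≡⟨ cong₂ _++_ (List.filter-none P? (All.tabulate (notBelow ∘ ∈-upTo⁻)))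
                                                             (List.filter-accept P? (p-prime , ∣-refl)) ⟩
    p ∷ []                                    ∎
    where
    open ≡-Reasoning
    P? = λ q → prime? q ×-dec q ∣? p
    notBelow : ∀ {q} → q ℕ.< p → ¬ (Prime q × q ∣ p)
    notBelow q<p (q-prime , q∣p) with prime⇒irreducible p-prime q∣p
    ... | inj₁ refl = ¬prime[1] q-prime
    ... | inj₂ refl = ℕP.<-irrefl refl q<p

  prime-squarefree : ∀ {x} → 2 ≤ x → ¬ (x ℕ.* x ∣ p)
  prime-squarefree {x} 2≤x xx∣p with prime⇒irreducible p-prime (m*n∣⇒m∣ x x xx∣p)
  ... | inj₁ refl = ℕP.<-irrefl refl 2≤x
  ... | inj₂ refl =
    ℕP.<-irrefl refl (ℕP.<-≤-trans 1<p (ℕP.*-cancelˡ-≤ x (ℕP.≤-trans (∣⇒≤ xx∣p) (ℕP.≤-reflexive (sym (ℕP.*-identityʳ x))))))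

  squareFactorTest-prime : ∀ x → ((2 ≤ᵇ x) ∧ divides? (x ℕ.* x) p) ≡ false
  squareFactorTest-prime x with 2 ℕ.≤? x
  ... | no  2≰x rewrite dec-false (2 ℕ.≤? x) 2≰x = refl
  ... | yes 2≤x rewrite dec-true (2 ℕ.≤? x) 2≤x = dec-false (x ℕ.* x ∣? p) (prime-squarefree 2≤x)

  μ-prime : μ p ≡ ℤ.- + 1
  μ-prime
    rewrite any-reject (λ x → (2 ≤ᵇ x) ∧ divides? (x ℕ.* x) p) {upTo (suc p)}
                       (All.tabulate (λ {x} _ → squareFactorTest-prime x))
          | primeDivisors-prime
    = refl

  μ-p^2+ : ∀ e → μ (p ^ suc (suc e)) ≡ + 0
  μ-p^2+ e = μ-squareful {{ℕP.m^n≢0 p (suc (suc e))}} 1<p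
               (subst (p ℕ.* p ∣_) (ℕP.*-assoc p p (p ^ e)) (m∣m*n (p ^ e)))

  ∣p^m⇒≡p^e : ∀ m {d} → d ∣ p ^ m → ∃[ e ] (e ≤ m × d ≡ p ^ e)
  ∣p^m⇒≡p^e zero    d∣1 = 0 , z≤n , ∣1⇒≡1 d∣1
  ∣p^m⇒≡p^e (suc m) {d} d∣p^m+1 with p ∣? d
  ... | yes (divides q refl) with ∣p^m⇒≡p^e m {q} (*-cancelʳ-∣ p (subst (q ℕ.* p ∣_) (ℕP.*-comm p (p ^ m)) d∣p^m+1))
  ...   | e , e≤m , refl = suc e , s≤s e≤m , ℕP.*-comm (p ^ e) p
  ∣p^m⇒≡p^e (suc m) {d} d∣p^m+1 | no p∤d with ∣p^m⇒≡p^e m (coprime-divisor d⊥p d∣p^m+1)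
    where
    d⊥p : Coprime d p
    d⊥p {i} (i∣d , i∣p) with prime⇒irreducible p-prime i∣p
    ... | inj₁ i≡1 = i≡1
    ... | inj₂ refl = ⊥-elim (p∤d i∣d)
  ... | e , e≤m , d≡p^e = e , ℕP.m≤n⇒m≤1+n e≤m , d≡p^e

  sumTo-indicator : ∀ (h : ℕ → ℤ) m c →
    sumTo (λ e → if does (p ^ e ℕ.≟ c) then h (p ^ e) else + 0) m ≡ (if does (c ∣? p ^ m) then h c else + 0)
  sumTo-indicator h m c with c ∣? p ^ m
  ... | no c∤p^m = sumTo-zero _ m (λ e e≤m → if-does-no (p ^ e ℕ.≟ c) (λ { refl → c∤p^m (^-monoʳ-∣ p e≤m) }))
  ... | yes c∣p^m with ∣p^m⇒≡p^e m c∣p^m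
  ...   | e₀ , e₀≤m , refl =
    trans (sumTo-single _ m e₀ e₀≤m (λ e _ e≢e₀ → if-does-no (p ^ e ℕ.≟ p ^ e₀) (e≢e₀ ∘ ^-injectiveʳ 1<p)))
          (if-does-yes (p ^ e₀ ℕ.≟ p ^ e₀) refl)

  divisorSumUpTo-primePower : ∀ h m N →
    divisorSumUpTo h (p ^ m) N ≡ sumTo (λ e → if does (p ^ e ℕ.≤? N) then h (p ^ e) else + 0) m
  divisorSumUpTo-primePower h m zero    =
    sym (sumTo-zero _ m (λ e _ → if-does-no (p ^ e ℕ.≤? 0) (ℕP.<⇒≱ (ℕP.m^n>0 p e))))
  divisorSumUpTo-primePower h m (suc N) = begin
    divisorSumUpTo h (p ^ m) (suc N)
      ≡⟨ divisorSumUpTo-suc h (p ^ m) N ⟩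
    divisorSumUpTo h (p ^ m) N ℤ.+ (if divides? (suc N) (p ^ m) then h (suc N) else + 0)
      ≡⟨ cong₂ ℤ._+_ (divisorSumUpTo-primePower h m N) (sym (sumTo-indicator h m (suc N))) ⟩
    sumTo (λ e → if does (p ^ e ℕ.≤? N) then h (p ^ e) else + 0) m ℤ.+
    sumTo (λ e → if does (p ^ e ℕ.≟ suc N) then h (p ^ e) else + 0) m
      ≡⟨ sym (sumTo-distrib-+ _ _ m) ⟩
    sumTo (λ e → (if does (p ^ e ℕ.≤? N) then h (p ^ e) else + 0) ℤ.+
                 (if does (p ^ e ℕ.≟ suc N) then h (p ^ e) else + 0)) m
      ≡⟨ sumTo-cong m (λ e _ → sym (split (p ^ e ℕ.≤? suc N) (p ^ e ℕ.≤? N) (p ^ e ℕ.≟ suc N))) ⟩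
    sumTo (λ e → if does (p ^ e ℕ.≤? suc N) then h (p ^ e) else + 0) m
      ∎
    where
    open ≡-Reasoning
    split : ∀ {x} {v : ℤ} (≤suc : Dec (x ≤ suc N)) (≤N : Dec (x ≤ N)) (≡suc : Dec (x ≡ suc N)) →
      (if does ≤suc then v else + 0) ≡ (if does ≤N then v else + 0) ℤ.+ (if does ≡suc then v else + 0)
    split (yes _)   (yes x≤N) (yes refl)  = ⊥-elim (ℕP.<-irrefl refl x≤N)
    split (yes _)   (yes _)   (no _)      = sym (ℤP.+-identityʳ _)
    split (yes _)   (no _)    (yes _)     = sym (ℤP.+-identityˡ _)
    split (yes x≤)  (no x≰N)  (no x≢)     = ⊥-elim (x≢ (ℕP.≤-antisym x≤ (ℕP.≰⇒> x≰N)))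
    split (no x≰)   (yes x≤N) _           = ⊥-elim (x≰ (ℕP.m≤n⇒m≤1+n x≤N))
    split (no x≰)   (no _)    (yes refl)  = ⊥-elim (x≰ ℕP.≤-refl)
    split (no _)    (no _)    (no _)      = refl

  divisorSum-primePower : ∀ h m → divisorSumUpTo h (p ^ m) (p ^ m) ≡ sumTo (h ∘ (p ^_)) m
  divisorSum-primePower h m = trans (divisorSumUpTo-primePower h m (p ^ m))
    (sumTo-cong m (λ e e≤m → if-does-yes (p ^ e ℕ.≤? p ^ m) (ℕP.^-monoʳ-≤ p e≤m)))

  quot-^ : ∀ {e′ e} → e′ ≤ e → quot (p ^ e) (p ^ e′) ≡ p ^ (e ∸ e′)
  quot-^ {e′} {e} e′≤e = begin
    quot (p ^ e) (p ^ e′)                  ≡⟨ cong (λ x → quot (p ^ x) (p ^ e′)) (sym (ℕP.m∸n+n≡m e′≤e)) ⟩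
    quot (p ^ (e ∸ e′ ℕ.+ e′)) (p ^ e′)    ≡⟨ cong (λ x → quot x (p ^ e′)) (ℕP.^-distribˡ-+-* p (e ∸ e′) e′) ⟩
    quot (p ^ (e ∸ e′) ℕ.* p ^ e′) (p ^ e′) ≡⟨ quot-*ˡ (p ^ (e ∸ e′)) (p ^ e′) {{ℕP.m^n≢0 p e′}} ⟩
    p ^ (e ∸ e′)                           ∎
    where open ≡-Reasoning

  +[p^e]^i : ∀ e i → + ((p ^ e) ^ i) ≡ (+ (p ^ i)) ℤ.^ e
  +[p^e]^i e i = trans (cong +_ (begin
    (p ^ e) ^ i  ≡⟨ ℕP.^-*-assoc p e i ⟩
    p ^ (e ℕ.* i) ≡⟨ cong (p ^_) (ℕP.*-comm e i) ⟩
    p ^ (i ℕ.* e) ≡⟨ ℕP.^-*-assoc p i e ⟨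
    (p ^ i) ^ e  ∎)) (+-^ (p ^ i) e)
    where open ≡-Reasoning

  J-primePower : ∀ i e → J i (p ^ e) ≡ Δ ((+ (p ^ i)) ℤ.^_) e
  J-primePower i zero    = begin
    J i 1              ≡⟨ divisorSum-primePower (λ g → μ g ℤ.* + (quot 1 g ^ i)) 0 ⟩
    + 1 ℤ.* + (1 ^ i)  ≡⟨ ℤP.*-identityˡ _ ⟩
    + (1 ^ i)          ≡⟨ cong +_ (ℕP.^-zeroˡ i) ⟩
    + 1                ∎
    where open ≡-Reasoning
  J-primePower i (suc e) = begin
    J i (p ^ suc e)
      ≡⟨ divisorSum-primePower term (suc e) ⟩
    sumTo (term ∘ (p ^_)) (suc e)
      ≡⟨ sumTo-first-two (term ∘ (p ^_)) e term-vanishes ⟩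
    μ 1 ℤ.* + (quot (p ^ suc e) 1 ^ i) ℤ.+ μ (p ℕ.* 1) ℤ.* + (quot (p ^ suc e) (p ^ 1) ^ i)
      ≡⟨ cong₂ (λ a b → + 1 ℤ.* + (a ^ i) ℤ.+ b) (n/1≡n (p ^ suc e))
               (cong₂ (λ g q → μ g ℤ.* + (q ^ i)) (ℕP.*-identityʳ p) (quot-^ {1} {suc e} (s≤s z≤n))) ⟩
    + 1 ℤ.* + ((p ^ suc e) ^ i) ℤ.+ μ p ℤ.* + ((p ^ e) ^ i)
      ≡⟨ cong₂ (λ a b → + 1 ℤ.* a ℤ.+ b) (+[p^e]^i (suc e) i) (cong₂ ℤ._*_ μ-prime (+[p^e]^i e i)) ⟩
    + 1 ℤ.* (x ℤ.* x ℤ.^ e) ℤ.+ (ℤ.- + 1) ℤ.* x ℤ.^ e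
      ≡⟨ identity x (x ℤ.^ e) ⟩
    x ℤ.* x ℤ.^ e ℤ.- x ℤ.^ e
      ∎
    where
    open ≡-Reasoning
    x = + (p ^ i)
    term : ℕ → ℤ
    term g = μ g ℤ.* + (quot (p ^ suc e) g ^ i)
    term-vanishes : ∀ k → term (p ^ suc (suc k)) ≡ + 0
    term-vanishes k = trans (cong (ℤ._* + (quot (p ^ suc e) (p ^ suc (suc k)) ^ i)) (μ-p^2+ k))
                            (ℤP.*-zeroˡ (+ (quot (p ^ suc e) (p ^ suc (suc k)) ^ i)))
    identity : ∀ x xᵉ → + 1 ℤ.* (x ℤ.* xᵉ) ℤ.+ (ℤ.- + 1) ℤ.* xᵉ ≡ x ℤ.* xᵉ ℤ.- xᵉ
    identity = solve-∀

  factorizationSum-primePower : ∀ f n i m → factorizationSum f (suc n) i (p ^ m)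
    ≡ sumTo (λ e → f i (p ^ e) ℤ.* factorizationSum f n (suc i) (p ^ (m ∸ e))) m
  factorizationSum-primePower f n i m =
    trans (factorizationSum-suc f n i (p ^ m))
    (trans (divisorSum-primePower (λ d → f i d ℤ.* factorizationSum f n (suc i) (quot (p ^ m) d)) m)
           (sumTo-cong m (λ e e≤m → cong (λ q → f i (p ^ e) ℤ.* factorizationSum f n (suc i) q) (quot-^ e≤m))))

  factorizationSum-zero-primePower : ∀ f i m → factorizationSum f 0 i (p ^ m) ≡ δ m
  factorizationSum-zero-primePower f i zero    = refl
  factorizationSum-zero-primePower f i (suc m)
    rewrite dec-false (p ^ suc m ℕ.≟ 1) (ℕP.>⇒≢ (ℕP.^-monoʳ-< p 1<p {0} {suc m} (s≤s z≤n))) = refl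

  a-primePower : ∀ n i m → factorizationSum (λ e d → + (d ^ e)) n i (p ^ m) ≡ geoProd (powersFrom p i n) m
  a-primePower zero    i m = factorizationSum-zero-primePower _ i m
  a-primePower (suc n) i m = begin
    factorizationSum (λ e d → + (d ^ e)) (suc n) i (p ^ m)
      ≡⟨ factorizationSum-primePower _ n i m ⟩
    sumTo (λ e → + ((p ^ e) ^ i) ℤ.* factorizationSum (λ e d → + (d ^ e)) n (suc i) (p ^ (m ∸ e))) m
      ≡⟨ sumTo-cong m (λ e _ → cong₂ ℤ._*_ (+[p^e]^i e i) (a-primePower n (suc i) (m ∸ e))) ⟩
    sumTo (λ e → (+ (p ^ i)) ℤ.^ e ℤ.* geoProd (powersFrom p (suc i) n) (m ∸ e)) m
      ≡⟨ geoConv-sum (+ (p ^ i)) _ m ⟩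
    geoProd (powersFrom p i (suc n)) m
      ∎
    where open ≡-Reasoning

  a′-primePower : ∀ n i m → factorizationSum J n i (p ^ m) ≡ Δ^ n (geoProd (powersFrom p i n)) m
  a′-primePower zero    i m = factorizationSum-zero-primePower J i m
  a′-primePower (suc n) i m = begin
    factorizationSum J (suc n) i (p ^ m)
      ≡⟨ factorizationSum-primePower J n i m ⟩
    sumTo (λ e → J i (p ^ e) ℤ.* factorizationSum J n (suc i) (p ^ (m ∸ e))) m
      ≡⟨ sumTo-cong m (λ e _ → cong₂ ℤ._*_ (J-primePower i e) (a′-primePower n (suc i) (m ∸ e))) ⟩
    sumTo (λ e → Δ (x ℤ.^_) e ℤ.* Δ^ n G (m ∸ e)) m
      ≡⟨ Δ-geoConv-sum x (Δ^ n G) m ⟩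
    Δ (geoConv x (Δ^ n G)) m
      ≡⟨ Δ-cong (geoConv-Δ^ x n G) m ⟩
    Δ (Δ^ n (geoConv x G)) m
      ∎
    where
    open ≡-Reasoning
    x = + (p ^ i)
    G = geoProd (powersFrom p (suc i) n)

  module Asymptotics (t : ℕ) where
    private
      N Q R K : ℕ
      N = suc (suc t)
      Q = p ^ suc t
      R = p ^ t
      K = 2 ^ suc t
      instance
        Q≢0 : ℕ.NonZero Q
        Q≢0 = ℕP.m^n≢0 p (suc t)
        R≢0 : ℕ.NonZero R
        R≢0 = ℕP.m^n≢0 p t

    B A : ℕ → ℤ
    B = geoProd (powersFrom p 0 (suc t))
    A = geoConv (+ Q) B

    Aℕ : ℕ → ℕ
    Aℕ = geoProdℕ (powersFrom p 0 N)

    geoProd≗A : geoProd (powersFrom p 0 N) ≗ A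
    geoProd≗A m = trans (cong (λ xs → geoProd xs m) (sym (powersFrom-∷ʳ p 0 (suc t))))
                        (geoProd-∷ʳ (powersFrom p 0 (suc t)) Q m)

    A≡+Aℕ : ∀ m → A m ≡ + Aℕ m
    A≡+Aℕ m = trans (sym (geoProd≗A m)) (geoProd≡+geoProdℕ (powersFrom p 0 N) m)

    D≡ : ∀ m → D N (p ^ m) ≡ Δ^ N A m ÷ℕ Aℕ m
    D≡ m = cong₂ _÷ℕ_ (trans (a′-primePower N 0 m) (Δ^-cong N geoProd≗A m))
                      (cong ℤ.∣_∣ (trans (a-primePower N 0 m) (geoProd≡+geoProdℕ (powersFrom p 0 N) m)))

    Aℕ-lower : ∀ m → p ^ m ℕ.* R ^ m ≤ Aℕ m
    Aℕ-lower m = begin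
      p ^ m ℕ.* R ^ m      ≡⟨ ^-distribʳ-* p R m ⟨
      Q ^ m                ≡⟨ ℕP.*-identityʳ (Q ^ m) ⟨
      Q ^ m ℕ.* 1          ≡⟨ cong (Q ^ m ℕ.*_) (geoProdℕ-zero (powersFrom p 0 (suc t))) ⟨
      Q ^ m ℕ.* geoProdℕ (powersFrom p 0 (suc t)) 0
                           ≤⟨ geoConvℕ-lower Q _ m ⟩
      geoConvℕ Q (geoProdℕ (powersFrom p 0 (suc t))) m
                           ≡⟨ geoProdℕ-∷ʳ (powersFrom p 0 (suc t)) Q m ⟨
      geoProdℕ (powersFrom p 0 (suc t) ∷ʳ Q) m
                           ≡⟨ cong (λ xs → geoProdℕ xs m) (powersFrom-∷ʳ p 0 (suc t)) ⟩
      Aℕ m                 ∎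
      where open ℕP.≤-Reasoning

    Aℕ-positive : ∀ m → 1 ≤ Aℕ m
    Aℕ-positive m = ℕP.≤-trans (ℕP.*-mono-≤ (ℕP.m^n>0 p m) (ℕP.m^n>0 R m)) (Aℕ-lower m)

    ∣B∣-upper : ∀ m → ℤ.∣ B m ∣ ≤ K ℕ.* R ^ m
    ∣B∣-upper m rewrite geoProd≡+geoProdℕ (powersFrom p 0 (suc t)) m = geoProdℕ-powersFrom-upper 1<p t m

    threshold : ℕ
    threshold = Δ^-defectBound p R K N

    D-primePower-close : ∀ ε → 0ℚ < ε → ∀ m → threshold ℕ.* ℚ.↧ₙ ε ≤ m →
      ∣ D N (p ^ m) - (1ℚ - (+ 1) ÷ℕ Q) ^ℚ N ∣ < ε
    D-primePower-close ε@(mkℚ (+ suc n) d _) _ m M≤m =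
      subst (λ x → ∣ x - (1ℚ - (+ 1) ÷ℕ Q) ^ℚ N ∣ < ε) (sym (D≡ m))
            (∣÷ℕ-[1-1/Q]^∣<-cross (Δ^ N A m) (Aℕ m) {{ℕ.>-nonZero (Aℕ-positive m)}} Q N ε cross)
      where
      E = Δ^-defect Q B N m
      small : ℤ.∣ E ∣ ℕ.* suc d ℕ.< suc n ℕ.* (Aℕ m ℕ.* Q ^ N)
      small = ℕP.<-≤-trans
        (dominated-< {c = threshold} (∣Δ^-defect∣-upper B p R K (ℕP.m^n>0 p (suc t)) ∣B∣-upper N m)
                     (ℕP.≤-<-trans M≤m (m<p^m 1<p m)) (Aℕ-lower m) (ℕP.m^n>0 R m))
        (ℕP.≤-trans (ℕP.m≤m*n (Aℕ m) (Q ^ N) {{ℕP.m^n≢0 Q N}}) (ℕP.m≤n*m (Aℕ m ℕ.* Q ^ N) (suc n)))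
      cross : + ℤ.∣ (+ Q) ℤ.^ N ℤ.* Δ^ N A m ℤ.- (+ Q ℤ.- + 1) ℤ.^ N ℤ.* + Aℕ m ∣ ℤ.* + suc d
              ℤ.< + suc n ℤ.* (+ Aℕ m ℤ.* (+ Q) ℤ.^ N)
      cross = subst₂ ℤ._<_
        (trans (ℤP.pos-* ℤ.∣ E ∣ (suc d))
               (cong (λ a → + ℤ.∣ (+ Q) ℤ.^ N ℤ.* Δ^ N A m ℤ.- (+ Q ℤ.- + 1) ℤ.^ N ℤ.* a ∣ ℤ.* + suc d) (A≡+Aℕ m)))
        (trans (ℤP.pos-* (suc n) _)
               (cong (+ suc n ℤ.*_) (trans (ℤP.pos-* (Aℕ m) (Q ^ N)) (cong (+ Aℕ m ℤ.*_) (+-^ Q N)))))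
        (ℤ.+<+ small)
    D-primePower-close (mkℚ (+ 0) _ _)     (*<* (ℤ.+<+ ()))
    D-primePower-close (mkℚ ℤ.-[1+ _ ] _ _) (*<* ())

lemma14 : (n : ℕ) → 3 ≤ n → (p : ℕ) → Prime p →
    (ε : ℚ) → 0ℚ < ε →
    ∃[ M ] ((m : ℕ) → M ≤ m →
      ∣ D n (p ^ m) - (1ℚ - ((+ 1) ÷ℕ (p ^ (n ∸ 1)))) ^ℚ n ∣ < ε)
-- The argument only needs n ≥ 2.
lemma14 (suc zero)    (s≤s ()) _ _ _ _
lemma14 (suc (suc t)) _ p p-prime ε ε>0 = threshold ℕ.* ℚ.↧ₙ ε , D-primePower-close ε ε>0
  where
  open PrimePower p-prime
  open Asymptotics t
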